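{- Let $\mathbb{I}$ be a consistent interval which is a bounded distributive lattice satisfying the Phoa principle and the disjunction property, and which is equipped with an internal sum structure that factors binary meets. Let $\mathcal{S}$ be the (reflective) subuniverse of types consisting of the based Segal complete sets. Then (1) if $X\in\mathcal{S}$ then $L(X)\in\mathcal{S}$; and (2) for each $X\in\mathcal{S}$, $L(X)$ is the Sierpiński cone of $X$ in $\mathcal{S}$: for every $C\in\mathcal{S}$, the map $$C^{L(X)}\to\textstyle\sum_{c:C}\sum_{g:\mathbb{I}\times X\to C}\prod_{x:X}c=g(0,x),\qquad h\mapsto\big(h(0,\mathsf{abort}),\ \lambda(i,x).\,h(i,\lambda\_.x),\ \lambda x.\,\mathsf{refl}\big)$$ is an equivalence (here $(0,\lambda\_.x)=(0,\mathsf{abort})$ since $[\![0]\!]$ is empty); i.e. the lax square with top $X=X$, left $X\to\{(0,\mathsf{abort})\}$, right $x\mapsto(1,\lambda\_.x)\colon X\hookrightarrow L(X)$, bottom $\{(0,\mathsf{abort})\}\hookrightarrow L(X)$ and 2-cell $(i,x)\mapsto(i,\lambda\_.x)$ is a co-comma square in $\mathcal{S}$.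
   Context: Homotopy type theory; a set is a 0-truncated type. An interval is a set $\mathbb{I}$ with bounded meet-semilattice structure $(0,1,\sqcap)$, $i\sqsubseteq j$ meaning $i\sqcap j=i$; $[\![i]\!]:\equiv(i=1)$. Consistent: $0\ne1$. $\mathbb{I}$ is a bounded distributive lattice if it additionally has binary joins $\sqcup$ making $(\mathbb{I},0,1,\sqcap,\sqcup)$ a bounded distributive lattice; it has the disjunction property if $[\![i\sqcup j]\!]\leftrightarrow[\![i]\!]\lor[\![j]\!]$. Phoa principle: every function $\alpha\colon\mathbb{I}\to\mathbb{I}$ is monotone, and any $\alpha,\beta\colon\mathbb{I}\to\mathbb{I}$ with $\alpha(0)=\beta(0)$ and $\alpha(1)=\beta(1)$ are equal. $L(X):\equiv\sum_{i:\mathbb{I}}X^{[\![i]\!]}$. An internal sum structure is a function $\Sigma\colon L(\mathbb{I})\to\mathbb{I}$ such that the square with top $\{(1,\lambda\_.1)\}\to\{1\}$, left the inclusion $\{(1,\lambda\_.1)\}\hookrightarrow L(\mathbb{I})$, right $\{1\}\hookrightarrow\mathbb{I}$ and bottom $\Sigma$ is a pullback; it factors binary meets if $\Sigma(i,\lambda\_.j)=i\sqcap j$ for all $i,j$. For $f\colon A\to B$, $X$ is $f$-local if $X^f\colon X^B\to X^A$ is an equivalence. $\mathbb{I}/j:\equiv\{i\mid i\sqsubseteq j\}$; $P*X$ is the join (pushout of $P\leftarrow P\times X\to X$); the Sierpiński cone of $X$ is $X_\bot:\equiv\sum_{i:\mathbb{I}}(i=0)*X$; $[\![j]\!]_\bot$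 is the Sierpiński cone of the proposition $[\![j]\!]$, $\simeq\{i\mid i=0\lor j=1\}$, included in $\mathbb{I}/j$ by $i\mapsto i$. A type is based Segal complete if for every $j:\mathbb{I}$ it is local with respect to $[\![j]\!]_\bot\hookrightarrow\mathbb{I}/j$. -}

module Defs where

-- Function extensionality and propositional truncation are not available
-- in safe, non-cubical Agda; they are taken as explicit hypotheses of the
-- theorem.

open import Level using (Level; _⊔_) renaming (suc to lsuc; zero to lzero)
open import Data.Product using (Σ; _×_; _,_; proj₁; proj₂)
open import Data.Sum using (_⊎_; inj₁; inj₂)
open import Data.Empty using (⊥; ⊥-elim)
open import Relation.Nullary using (¬_)
open import Relation.Binary.PropositionalEquality
  using (_≡_; refl; sym; trans; cong)
open import Axiom.Extensionality.Propositional using (Extensionality)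

FunExt : Set₁
FunExt = Extensionality lzero lzero

isProp : Set → Set
isProp A = (x y : A) → x ≡ y

isSet : Set → Set
isSet A = (x y : A) → isProp (x ≡ y)

isContr : Set → Set
isContr A = Σ A λ c → (x : A) → c ≡ x

fiber : {A B : Set} → (A → B) → B → Set
fiber {A} f b = Σ A λ a → f a ≡ b

isEquiv : {A B : Set} → (A → B) → Set
isEquiv {B = B} f = (b : B) → isContr (fiber f b)

isLocal : {A B : Set} → (A → B) → Set → Set
isLocal {A} {B} f X = isEquiv {B → X} {A → X} (λ g a → g (f a))

record PropTrunc : Set₁ where
  field
    ∥_∥      : Set → Set
    ∣_∣      : {A : Set} → A → ∥ A ∥
    ∥∥-isProp : {A : Set} → isProp ∥ A ∥
    ∥∥-rec   : {A P : Set} → isProp P → (A → P) → ∥ A ∥ → P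

  infixr 4 _∨_
  _∨_ : Set → Set → Set
  A ∨ B = ∥ A ⊎ B ∥

record Interval : Set₁ where
  infixl 7 _⊓_
  field
    𝕀       : Set
    𝕀-isSet : isSet 𝕀
    𝟘 𝟙     : 𝕀
    _⊓_     : 𝕀 → 𝕀 → 𝕀
    ⊓-assoc : (i j k : 𝕀) → (i ⊓ j) ⊓ k ≡ i ⊓ (j ⊓ k)
    ⊓-comm  : (i j : 𝕀) → i ⊓ j ≡ j ⊓ i
    ⊓-idem  : (i : 𝕀) → i ⊓ i ≡ i
    ⊓-top   : (i : 𝕀) → i ⊓ 𝟙 ≡ i
    ⊓-bot   : (i : 𝕀) → 𝟘 ⊓ i ≡ 𝟘

  infix 4 _⊑_
  _⊑_ : 𝕀 → 𝕀 → Set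
  i ⊑ j = i ⊓ j ≡ i

  ⟦_⟧ : 𝕀 → Set
  ⟦ i ⟧ = i ≡ 𝟙

  L : Set → Set
  L X = Σ 𝕀 λ i → ⟦ i ⟧ → X

  Consistent : Set
  Consistent = ¬ (𝟘 ≡ 𝟙)

  -- Phoa principle (stated with ≡ on functions; funext is assumed)
  Phoa : Set
  Phoa = ((α : 𝕀 → 𝕀) (i j : 𝕀) → i ⊑ j → α i ⊑ α j)
       × ((α β : 𝕀 → 𝕀) → α 𝟘 ≡ β 𝟘 → α 𝟙 ≡ β 𝟙 → α ≡ β)

  record IsBDL (_⊔_ : 𝕀 → 𝕀 → 𝕀) : Set where
    field
      ⊔-assoc  : (i j k : 𝕀) → (i ⊔ j) ⊔ k ≡ i ⊔ (j ⊔ k)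
      ⊔-comm   : (i j : 𝕀) → i ⊔ j ≡ j ⊔ i
      ⊔-idem   : (i : 𝕀) → i ⊔ i ≡ i
      ⊔-bot    : (i : 𝕀) → i ⊔ 𝟘 ≡ i
      ⊔-top    : (i : 𝕀) → i ⊔ 𝟙 ≡ 𝟙
      absorb-⊔⊓ : (i j : 𝕀) → i ⊔ (i ⊓ j) ≡ i
      absorb-⊓⊔ : (i j : 𝕀) → i ⊓ (i ⊔ j) ≡ i
      distrib  : (i j k : 𝕀) → i ⊓ (j ⊔ k) ≡ (i ⊓ j) ⊔ (i ⊓ k)

  DisjunctionProperty : PropTrunc → (𝕀 → 𝕀 → 𝕀) → Set
  DisjunctionProperty PT _⊔_ = (i j : 𝕀) →
      (⟦ i ⊔ j ⟧ → ⟦ i ⟧ ∨ ⟦ j ⟧) × (⟦ i ⟧ ∨ ⟦ j ⟧ → ⟦ i ⊔ j ⟧)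
    where open PropTrunc PT

  -- Internal sum structure: the square
  --   {(1,λ_.1)} → {1}
  --       ↓          ↓
  --     L(𝕀)  --Σ--> 𝕀
  -- commutes and is a pullback (the gap map is an equivalence).
  top1 : L 𝕀
  top1 = 𝟙 , λ _ → 𝟙

  PullbackGap : (Σs : L 𝕀 → 𝕀) → Σs top1 ≡ 𝟙 →
    (Σ (L 𝕀) λ p → p ≡ top1) →
    Σ (L 𝕀) λ p → Σ (Σ 𝕀 λ i → i ≡ 𝟙) λ u → Σs p ≡ proj₁ u
  PullbackGap Σs h (p , e) = p , (𝟙 , refl) , trans (cong Σs e) h

  IsInternalSum : (L 𝕀 → 𝕀) → Set
  IsInternalSum Σs = Σ (Σs top1 ≡ 𝟙) λ h → isEquiv (PullbackGap Σs h)

  FactorsBinaryMeets : (L 𝕀 → 𝕀) → Set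
  FactorsBinaryMeets Σs = (i j : 𝕀) → Σs (i , λ _ → j) ≡ i ⊓ j

  Slice : 𝕀 → Set
  Slice j = Σ 𝕀 λ i → i ⊑ j

  module _ (PT : PropTrunc) where
    open PropTrunc PT

    -- ⟦j⟧_⊥ ≃ {i | i = 0 ∨ j = 1}
    ConeJ : 𝕀 → Set
    ConeJ j = Σ 𝕀 λ i → (i ≡ 𝟘) ∨ (j ≡ 𝟙)

    coneJ⊑ : (i j : 𝕀) → (i ≡ 𝟘) ∨ (j ≡ 𝟙) → i ⊑ j
    coneJ⊑ i j = ∥∥-rec (𝕀-isSet (i ⊓ j) i) f
      where
        f : (i ≡ 𝟘) ⊎ (j ≡ 𝟙) → i ⊓ j ≡ i
        f (inj₁ refl) = ⊓-bot j
        f (inj₂ refl) = ⊓-top i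

    coneJ-incl : (j : 𝕀) → ConeJ j → Slice j
    coneJ-incl j (i , p) = i , coneJ⊑ i j p

    BasedSegalComplete : Set → Set
    BasedSegalComplete X = (j : 𝕀) → isLocal (coneJ-incl j) X

    In𝒮 : Set → Set
    In𝒮 X = isSet X × BasedSegalComplete X

  module _ (fe : FunExt) (cons : Consistent) where
    abort : {X : Set} → ⟦ 𝟘 ⟧ → X
    abort p = ⊥-elim (cons p)

    bot≡ : {X : Set} (x : X) → _≡_ {A = L X} (𝟘 , abort) (𝟘 , λ _ → x)
    bot≡ x = cong (𝟘 ,_) (fe (λ p → ⊥-elim (cons p)))

    coconeMap : (X C : Set) → (L X → C) →
      Σ C λ c → Σ (𝕀 × X → C) λ g → (x : X) → c ≡ g (𝟘 , x)
    coconeMap X C h =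
      h (𝟘 , abort) , (λ { (i , x) → h (i , λ _ → x) }) , (λ x → cong h (bot≡ x))

{-# OPTIONS --safe #-}
module Submission where

-- By the Phoa principle every ψ : 𝕀/j → 𝕀 is k ↦ ψ 0 ⊔ (k ⊓ ψ j), and since Σ factors
-- meets, k ⊓ ψ j = k ⊓ Σ (j , λ _ → ψ 1) only depends on ψ restricted to ⟦j⟧_⊥; so 𝕀 is
-- based Segal complete. A map 𝕀/j → L X is a level ψ : 𝕀/j → 𝕀 together with a partial
-- map into X. Where ψ is true, the disjunction property says that either ψ is true at 0,
-- hence everywhere, and the partial map is total and extends by locality of X; or ⟦j⟧
-- holds, and then ⟦j⟧_⊥ is all of 𝕀/j. For the co-comma property, a cocone (c , g , e)
-- yields for (i , u) : L X the map on ⟦i⟧_⊥ that is c at 0 and g (k , u _) where ⟦i⟧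
-- holds; h (i , u) is the value at i of its extension to 𝕀/i.

open import Defs
open import Axiom.UniquenessOfIdentityProofs using (module Constant⇒UIP)
open import Data.Product using (Σ; _×_; _,_; proj₁; proj₂)
open import Data.Product.Properties using (Σ-≡,≡→≡; Σ-≡,≡←≡)
open import Data.Sum using (_⊎_; inj₁; inj₂; [_,_]; [_,_]′)
open import Data.Empty using (⊥-elim)
open import Function using (_∘_)
open import Relation.Binary.PropositionalEquality
  using (_≡_; refl; sym; trans; cong; cong₂; cong-app; module ≡-Reasoning)

open ≡-Reasoning

isProp⇒isSet : {A : Set} → isProp A → isSet A
isProp⇒isSet P _ _ = Constant⇒UIP.≡-irrelevant (λ {x} {y} _ → P x y) (λ _ _ → refl)

Σ≡Prop : {A : Set} {B : A → Set} → ((a : A) → isProp (B a)) →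
  {u v : Σ A B} → proj₁ u ≡ proj₁ v → u ≡ v
Σ≡Prop P {a , b} {.a , b′} refl = cong (a ,_) (P a b b′)

isSet-Σ : {A : Set} {B : A → Set} → isSet A → ((a : A) → isSet (B a)) → isSet (Σ A B)
isSet-Σ {A} {B} SA SB _ _ = Constant⇒UIP.≡-irrelevant normalise normalise-constant
  where
    normalise : {u v : Σ A B} → u ≡ v → u ≡ v
    normalise r = Σ-≡,≡→≡ (Σ-≡,≡←≡ r)

    normalise-constant : {u v : Σ A B} (r r′ : u ≡ v) → normalise r ≡ normalise r′
    normalise-constant {_ , _} {a′ , _} _ _ =
      cong Σ-≡,≡→≡ (Σ≡Prop (λ _ → SB a′ _ _) (SA _ _ _ _))

isProp-Π : FunExt → {A : Set} {B : A → Set} → ((a : A) → isProp (B a)) →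
  isProp ((a : A) → B a)
isProp-Π fe P f g = fe (λ a → P a (f a) (g a))

isSet-Π : FunExt → {A : Set} {B : A → Set} → ((a : A) → isSet (B a)) →
  isSet ((a : A) → B a)
isSet-Π fe S _ _ = Constant⇒UIP.≡-irrelevant (λ r → fe (cong-app r))
  (λ r r′ → cong fe (fe (λ a → S a _ _ (cong-app r a) (cong-app r′ a))))

isEquiv⇒injective : {A B : Set} {f : A → B} → isEquiv f → {a a′ : A} → f a ≡ f a′ → a ≡ a′
isEquiv⇒injective {f = f} e {a} {a′} p =
  cong proj₁ (trans (sym (proj₂ (e (f a′)) (a , p))) (proj₂ (e (f a′)) (a′ , refl)))

injective∧surjective⇒isEquiv : {A B : Set} (f : A → B) → isSet B →
  ((b : B) → fiber f b) → ((a a′ : A) → f a ≡ f a′ → a ≡ a′) → isEquiv f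
injective∧surjective⇒isEquiv f SB surj inj b =
  surj b , λ (a′ , p′) → Σ≡Prop (λ a → SB (f a) b) (inj _ a′ (trans (proj₂ (surj b)) (sym p′)))

module Local {A B X : Set} (f : A → B) (loc : isLocal f X) where

  extend : (A → X) → B → X
  extend φ = proj₁ (proj₁ (loc φ))

  extend-β : (φ : A → X) (a : A) → extend φ (f a) ≡ φ a
  extend-β φ = cong-app (proj₂ (proj₁ (loc φ)))

  restriction-injective : FunExt → (ψ ψ′ : B → X) →
    ((a : A) → ψ (f a) ≡ ψ′ (f a)) → (b : B) → ψ b ≡ ψ′ b
  restriction-injective fe ψ ψ′ agree = cong-app (isEquiv⇒injective loc (fe agree))

isLocal-intro : FunExt → {A B X : Set} (f : A → B) → isSet X →
  ((φ : A → X) → Σ (B → X) λ ψ → (a : A) → ψ (f a) ≡ φ a) →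
  ((ψ ψ′ : B → X) → ((a : A) → ψ (f a) ≡ ψ′ (f a)) → (b : B) → ψ b ≡ ψ′ b) →
  isLocal f X
isLocal-intro fe f SX extension unique =
  injective∧surjective⇒isEquiv _ (isSet-Π fe (λ _ → SX))
    (λ φ → proj₁ (extension φ) , fe (proj₂ (extension φ)))
    (λ ψ ψ′ e → fe (unique ψ ψ′ (cong-app e)))

module PropTruncProperties (PT : PropTrunc) where
  open PropTrunc PT

  -- The image of a weakly constant map into a set is a proposition.
  module ∥∥-RecSet {A C : Set} (SC : isSet C) (f : A → C)
    (f-const : (a a′ : A) → f a ≡ f a′) where

    private
      Image : Set
      Image = Σ C λ c → ∥ fiber f c ∥

      Image-isProp : isProp Image
      Image-isProp (c , t) (c′ , t′) = Σ≡Prop (λ _ → ∥∥-isProp)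
        (∥∥-rec (SC c c′) (λ (a , e) → ∥∥-rec (SC c c′)
          (λ (a′ , e′) → trans (sym e) (trans (f-const a a′) e′)) t′) t)

      image : ∥ A ∥ → Image
      image = ∥∥-rec Image-isProp (λ a → f a , ∣ a , refl ∣)

    rec : ∥ A ∥ → C
    rec = proj₁ ∘ image

    rec-≡ : (t : ∥ A ∥) {c : C} → ((a : A) → f a ≡ c) → rec t ≡ c
    rec-≡ t agree = ∥∥-rec (SC _ _)
      (λ a → trans (cong proj₁ (Image-isProp (image t) (f a , ∣ a , refl ∣))) (agree a)) t

  module ∨-RecSet {A B C : Set} (SC : isSet C) (PA : isProp A) (PB : isProp B)
    (f : A → C) (g : B → C) (agree : (a : A) (b : B) → f a ≡ g b) where

    private
      [f,g]-const : (w w′ : A ⊎ B) → [ f , g ]′ w ≡ [ f , g ]′ w′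
      [f,g]-const (inj₁ a) (inj₁ a′) = cong f (PA a a′)
      [f,g]-const (inj₁ a) (inj₂ b′) = agree a b′
      [f,g]-const (inj₂ b) (inj₁ a′) = sym (agree a′ b)
      [f,g]-const (inj₂ b) (inj₂ b′) = cong g (PB b b′)

      open ∥∥-RecSet SC [ f , g ]′ [f,g]-const

    ∨-rec : A ∨ B → C
    ∨-rec = rec

    ∨-rec-≡ : (t : A ∨ B) {c : C} → ((a : A) → f a ≡ c) → ((b : B) → g b ≡ c) → ∨-rec t ≡ c
    ∨-rec-≡ t hf hg = rec-≡ t [ hf , hg ]

module _ (fe : FunExt) (PT : PropTrunc) (I : Interval) where
  open Interval I
  open PropTrunc PT
  open PropTruncProperties PT

  incl : (j : 𝕀) → ConeJ PT j → Slice j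
  incl = coneJ-incl PT

  cone-≡ : {j : 𝕀} {c c′ : ConeJ PT j} → proj₁ c ≡ proj₁ c′ → c ≡ c′
  cone-≡ = Σ≡Prop (λ _ → ∥∥-isProp)

  slice-≡ : {j : 𝕀} {s s′ : Slice j} → proj₁ s ≡ proj₁ s′ → s ≡ s′
  slice-≡ {j} = Σ≡Prop (λ i → 𝕀-isSet (i ⊓ j) i)

  ⊥ᶜ : (j : 𝕀) → ConeJ PT j
  ⊥ᶜ j = 𝟘 , ∣ inj₁ refl ∣

  ⊥ˢ : (j : 𝕀) → Slice j
  ⊥ˢ j = 𝟘 , ⊓-bot j

  ⊤ˢ : (j : 𝕀) → Slice j
  ⊤ˢ j = j , ⊓-idem j

  cone-⟦⟧ : {j : 𝕀} → ⟦ j ⟧ → Slice j → ConeJ PT j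
  cone-⟦⟧ p (k , _) = k , ∣ inj₂ p ∣

  incl-cone-⟦⟧ : {j : 𝕀} (p : ⟦ j ⟧) (s : Slice j) → incl j (cone-⟦⟧ p s) ≡ s
  incl-cone-⟦⟧ _ _ = slice-≡ refl

  ⊓-identityˡ : (i : 𝕀) → 𝟙 ⊓ i ≡ i
  ⊓-identityˡ i = trans (⊓-comm 𝟙 i) (⊓-top i)

  ⟦⟧-mono : {i j : 𝕀} → i ⊑ j → ⟦ i ⟧ → ⟦ j ⟧
  ⟦⟧-mono {i} {j} i⊑j i≡1 = begin
    j      ≡⟨ sym (⊓-identityˡ j) ⟩
    𝟙 ⊓ j  ≡⟨ cong (_⊓ j) (sym i≡1) ⟩
    i ⊓ j  ≡⟨ i⊑j ⟩
    i      ≡⟨ i≡1 ⟩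
    𝟙      ∎

  ⟦⊓⟧ˡ : (i j : 𝕀) → ⟦ i ⊓ j ⟧ → ⟦ i ⟧
  ⟦⊓⟧ˡ i j = ⟦⟧-mono (begin
    (i ⊓ j) ⊓ i  ≡⟨ ⊓-comm (i ⊓ j) i ⟩
    i ⊓ (i ⊓ j)  ≡⟨ sym (⊓-assoc i i j) ⟩
    (i ⊓ i) ⊓ j  ≡⟨ cong (_⊓ j) (⊓-idem i) ⟩
    i ⊓ j        ∎)

  ⟦⟧-irrelevant : {X : Set} {i : 𝕀} (u : ⟦ i ⟧ → X) {r r′ : ⟦ i ⟧} → u r ≡ u r′
  ⟦⟧-irrelevant u = cong u (𝕀-isSet _ _ _ _)

  L-≡ : {X : Set} {i i′ : 𝕀} {u : ⟦ i ⟧ → X} {u′ : ⟦ i′ ⟧ → X} → i ≡ i′ →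
    ((r : ⟦ i ⟧) (r′ : ⟦ i′ ⟧) → u r ≡ u′ r′) → _≡_ {A = L X} (i , u) (i′ , u′)
  L-≡ refl agree = cong (_ ,_) (fe (λ r → agree r r))

  L-app : {X : Set} {p p′ : L X} → p ≡ p′ →
    (r : ⟦ proj₁ p ⟧) (r′ : ⟦ proj₁ p′ ⟧) → proj₂ p r ≡ proj₂ p′ r′
  L-app {p = _ , u} refl _ _ = ⟦⟧-irrelevant u

  isSet-L : {X : Set} → isSet X → isSet (L X)
  isSet-L SX = isSet-Σ 𝕀-isSet (λ _ → isSet-Π fe (λ _ → SX))

  restrict : {X : Set} (p : L X) → Slice (proj₁ p) → L X
  restrict (_ , u) (k , k⊑i) = k , u ∘ ⟦⟧-mono k⊑i

  restrict-⊤ : {X : Set} (p : L X) → restrict p (⊤ˢ (proj₁ p)) ≡ p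
  restrict-⊤ (_ , u) = L-≡ refl (λ _ _ → ⟦⟧-irrelevant u)

  restrict-⟦⟧ : {X : Set} (p : L X) (r : ⟦ proj₁ p ⟧) (s : Slice (proj₁ p)) →
    restrict p s ≡ (proj₁ s , λ _ → proj₂ p r)
  restrict-⟦⟧ (_ , u) _ _ = L-≡ refl (λ _ _ → ⟦⟧-irrelevant u)

  module _ (cons : Consistent) where

    restrict-⊥ : {X : Set} (p : L X) (s : Slice (proj₁ p)) → proj₁ s ≡ 𝟘 →
      restrict p s ≡ (𝟘 , abort fe cons)
    restrict-⊥ _ _ k≡0 = L-≡ k≡0 (λ _ r → ⊥-elim (cons r))

    Cocone : Set → Set → Set
    Cocone X C = Σ C λ c → Σ (𝕀 × X → C) λ g → (x : X) → c ≡ g (𝟘 , x)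

    module _ {X C : Set} (SC : isSet C) (locC : BasedSegalComplete PT C) where

      Cocone-isSet : isSet (Cocone X C)
      Cocone-isSet = isSet-Σ SC (λ _ → isSet-Σ (isSet-Π fe (λ _ → SC))
        (λ _ → isProp⇒isSet (isProp-Π fe (λ _ → SC _ _))))

      Cocone-≡ : {c c′ : C} {g g′ : 𝕀 × X → C}
        {e : (x : X) → c ≡ g (𝟘 , x)} {e′ : (x : X) → c′ ≡ g′ (𝟘 , x)} →
        c ≡ c′ → g ≡ g′ → _≡_ {A = Cocone X C} (c , g , e) (c′ , g′ , e′)
      Cocone-≡ refl refl = cong (λ e → _ , _ , e) (isProp-Π fe (λ _ → SC _ _) _ _)

      -- Every element of L X is the top of its restriction to 𝕀/i, which on the
      -- cone ⟦i⟧_⊥ only takes the values (0, abort) and (k, λ_.x).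
      coconeMap-injective : (H H′ : L X → C) →
        coconeMap fe cons X C H ≡ coconeMap fe cons X C H′ → (p : L X) → H p ≡ H′ p
      coconeMap-injective H H′ eq p@(i , u) = begin
        H p                          ≡⟨ cong H (sym (restrict-⊤ p)) ⟩
        H (restrict p (⊤ˢ i))        ≡⟨ Local.restriction-injective (incl i) (locC i) fe
                                          (H ∘ restrict p) (H′ ∘ restrict p) agree (⊤ˢ i) ⟩
        H′ (restrict p (⊤ˢ i))       ≡⟨ cong H′ (restrict-⊤ p) ⟩
        H′ p                         ∎
        where
          via : {q q′ : L X} → q ≡ q′ → H q′ ≡ H′ q′ → H q ≡ H′ q
          via e agree′ = trans (cong H e) (trans agree′ (cong H′ (sym e)))

          agree : (c : ConeJ PT i) → H (restrict p (incl i c)) ≡ H′ (restrict p (incl i c))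
          agree (k , w) = ∥∥-rec (SC _ _) [ at-⊥ , at-⟦⟧ ] w
            where
              s : Slice i
              s = incl i (k , w)

              at-⊥ : k ≡ 𝟘 → H (restrict p s) ≡ H′ (restrict p s)
              at-⊥ k≡0 = via (restrict-⊥ p s k≡0) (cong proj₁ eq)

              at-⟦⟧ : ⟦ i ⟧ → H (restrict p s) ≡ H′ (restrict p s)
              at-⟦⟧ r = via (restrict-⟦⟧ p r s) (cong-app (cong (proj₁ ∘ proj₂) eq) (k , u r))

      module CoconeExtension (c : C) (g : 𝕀 × X → C) (e : (x : X) → c ≡ g (𝟘 , x)) where

        module Boundary (p : L X) (k : 𝕀) = ∨-RecSet SC (𝕀-isSet k 𝟘) (𝕀-isSet (proj₁ p) 𝟙)
          (λ _ → c) (λ r → g (k , proj₂ p r))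
          (λ k≡0 r → trans (e (proj₂ p r)) (cong (λ m → g (m , proj₂ p r)) (sym k≡0)))

        boundary : (p : L X) → ConeJ PT (proj₁ p) → C
        boundary p (k , w) = Boundary.∨-rec p k w

        H : L X → C
        H p = Local.extend (incl (proj₁ p)) (locC (proj₁ p)) (boundary p) (⊤ˢ (proj₁ p))

        H-⊥ : H (𝟘 , abort fe cons) ≡ c
        H-⊥ = begin
          extend (boundary p₀) (⊤ˢ 𝟘)           ≡⟨ cong (extend (boundary p₀)) (slice-≡ refl) ⟩
          extend (boundary p₀) (incl 𝟘 (⊥ᶜ 𝟘))  ≡⟨ extend-β (boundary p₀) (⊥ᶜ 𝟘) ⟩
          boundary p₀ (⊥ᶜ 𝟘)                    ≡⟨ Boundary.∨-rec-≡ p₀ 𝟘 _ (λ _ → refl)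
                                                                            (⊥-elim ∘ cons) ⟩
          c                                     ∎
          where
            p₀ : L X
            p₀ = 𝟘 , abort fe cons
            open Local (incl 𝟘) (locC 𝟘)

        H-const : (i : 𝕀) (x : X) → H (i , λ _ → x) ≡ g (i , x)
        H-const i x =
          restriction-injective fe (extend (boundary p)) (λ s → g (proj₁ s , x)) agree (⊤ˢ i)
          where
            p : L X
            p = i , λ _ → x
            open Local (incl i) (locC i)

            agree : (c′ : ConeJ PT i) → extend (boundary p) (incl i c′) ≡ g (proj₁ c′ , x)
            agree (k , w) = trans (extend-β (boundary p) (k , w)) (Boundary.∨-rec-≡ p k w
              (λ k≡0 → trans (e x) (cong (λ m → g (m , x)) (sym k≡0))) (λ _ → refl))

      coconeMap-surjective : (y : Cocone X C) → fiber (coconeMap fe cons X C) y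
      coconeMap-surjective (c , g , e) = H , Cocone-≡ H-⊥ (fe (λ (i , x) → H-const i x))
        where open CoconeExtension c g e

      coconeMap-isEquiv : isEquiv (coconeMap fe cons X C)
      coconeMap-isEquiv = injective∧surjective⇒isEquiv _ Cocone-isSet coconeMap-surjective
        (λ H H′ eq → fe (coconeMap-injective H H′ eq))

  module _ (_⊔_ : 𝕀 → 𝕀 → 𝕀) (bdl : IsBDL _⊔_) (phoa : Phoa) where
    open IsBDL bdl

    i⊔[𝟘⊓j]≡i : (i j : 𝕀) → i ⊔ (𝟘 ⊓ j) ≡ i
    i⊔[𝟘⊓j]≡i i j = trans (cong (i ⊔_) (⊓-bot j)) (⊔-bot i)

    ⊑⇒⊔≡ : {i j : 𝕀} → i ⊑ j → i ⊔ j ≡ j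
    ⊑⇒⊔≡ {i} {j} i⊑j = begin
      i ⊔ j            ≡⟨ cong (_⊔ j) (sym i⊑j) ⟩
      (i ⊓ j) ⊔ j      ≡⟨ ⊔-comm (i ⊓ j) j ⟩
      j ⊔ (i ⊓ j)      ≡⟨ cong (j ⊔_) (⊓-comm i j) ⟩
      j ⊔ (j ⊓ i)      ≡⟨ absorb-⊔⊓ j i ⟩
      j                ∎

    phoa-normalForm : (α : 𝕀 → 𝕀) (k : 𝕀) → α k ≡ α 𝟘 ⊔ (k ⊓ α 𝟙)
    phoa-normalForm α = cong-app (proj₂ phoa α affine (sym at-𝟘) (sym at-𝟙))
      where
        affine : 𝕀 → 𝕀
        affine k = α 𝟘 ⊔ (k ⊓ α 𝟙)

        at-𝟘 : affine 𝟘 ≡ α 𝟘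
        at-𝟘 = i⊔[𝟘⊓j]≡i (α 𝟘) (α 𝟙)

        at-𝟙 : affine 𝟙 ≡ α 𝟙
        at-𝟙 = trans (cong (α 𝟘 ⊔_) (⊓-identityˡ (α 𝟙)))
                     (⊑⇒⊔≡ (proj₁ phoa α 𝟘 𝟙 (⊓-top 𝟘)))

    slice-normalForm : {j : 𝕀} (ψ : Slice j → 𝕀) (s : Slice j) →
      ψ s ≡ ψ (⊥ˢ j) ⊔ (proj₁ s ⊓ ψ (⊤ˢ j))
    slice-normalForm {j} ψ (k , k⊑j) = begin
      ψ (k , k⊑j)                  ≡⟨ cong ψ (slice-≡ (sym k⊑j)) ⟩
      α k                          ≡⟨ phoa-normalForm α k ⟩
      α 𝟘 ⊔ (k ⊓ α 𝟙)              ≡⟨ cong₂ (λ x y → x ⊔ (k ⊓ y))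
                                         (cong ψ (slice-≡ (⊓-bot j)))
                                         (cong ψ (slice-≡ (⊓-identityˡ j))) ⟩
      ψ (⊥ˢ j) ⊔ (k ⊓ ψ (⊤ˢ j))    ∎
      where
        α : 𝕀 → 𝕀
        α m = ψ (m ⊓ j , trans (⊓-assoc m j j) (cong (m ⊓_) (⊓-idem j)))

    ⟦⟧-⊥⇒everywhere : {j : 𝕀} (ψ : Slice j → 𝕀) → ⟦ ψ (⊥ˢ j) ⟧ → (s : Slice j) → ⟦ ψ s ⟧
    ⟦⟧-⊥⇒everywhere {j} ψ ψ⊥≡1 s = begin
      ψ s                               ≡⟨ slice-normalForm ψ s ⟩
      ψ (⊥ˢ j) ⊔ (proj₁ s ⊓ ψ (⊤ˢ j))   ≡⟨ cong (_⊔ (proj₁ s ⊓ ψ (⊤ˢ j))) ψ⊥≡1 ⟩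
      𝟙 ⊔ (proj₁ s ⊓ ψ (⊤ˢ j))          ≡⟨ trans (⊔-comm 𝟙 _) (⊔-top _) ⟩
      𝟙                                 ∎

    ⟦⟧-dichotomy : DisjunctionProperty PT _⊔_ → {j : 𝕀} (ψ : Slice j → 𝕀) (s : Slice j) →
      ⟦ ψ s ⟧ → ⟦ ψ (⊥ˢ j) ⟧ ∨ ⟦ j ⟧
    ⟦⟧-dichotomy dp {j} ψ s@(k , k⊑j) ψs≡1 =
      ∥∥-rec ∥∥-isProp (λ w → ∣ [ inj₁ , inj₂ ∘ ⟦⟧-mono k⊑j ∘ ⟦⊓⟧ˡ k (ψ (⊤ˢ j)) ]′ w ∣)
        (proj₁ (dp _ _) (trans (sym (slice-normalForm ψ s)) ψs≡1))

    module _ (Σs : L 𝕀 → 𝕀) (fbm : FactorsBinaryMeets Σs) where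

      -- By slice-normalForm every ψ : 𝕀/j → 𝕀 is k ↦ ψ 0 ⊔ (k ⊓ ψ j), and
      -- k ⊓ ψ j = k ⊓ Σ (j , λ _ → ψ 1) because Σ factors meets.
      affineExtension : {j : 𝕀} → (ConeJ PT j → 𝕀) → Slice j → 𝕀
      affineExtension {j} a (k , _) = a (⊥ᶜ j) ⊔ (k ⊓ Σs (j , λ p → a (𝟙 , ∣ inj₂ p ∣)))

      affineExtension-unique : {j : 𝕀} (ψ : Slice j → 𝕀) (s : Slice j) →
        ψ s ≡ affineExtension (ψ ∘ incl j) s
      affineExtension-unique {j} ψ s@(k , k⊑j) = begin
        ψ s                                          ≡⟨ slice-normalForm ψ s ⟩
        ψ (⊥ˢ j) ⊔ (k ⊓ ψ (⊤ˢ j))                    ≡⟨ cong₂ _⊔_ (cong ψ (slice-≡ refl)) top ⟩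
        ψ (incl j (⊥ᶜ j)) ⊔ (k ⊓ Σs (j , ψ ∘ at-𝟙))  ∎
        where
          at-𝟙 : ⟦ j ⟧ → Slice j
          at-𝟙 p = incl j (𝟙 , ∣ inj₂ p ∣)

          top : k ⊓ ψ (⊤ˢ j) ≡ k ⊓ Σs (j , ψ ∘ at-𝟙)
          top = begin
            k ⊓ ψ (⊤ˢ j)              ≡⟨ cong (_⊓ ψ (⊤ˢ j)) (sym k⊑j) ⟩
            (k ⊓ j) ⊓ ψ (⊤ˢ j)        ≡⟨ ⊓-assoc k j _ ⟩
            k ⊓ (j ⊓ ψ (⊤ˢ j))        ≡⟨ cong (k ⊓_) (sym (fbm j _)) ⟩
            k ⊓ Σs (j , λ _ → ψ (⊤ˢ j)) ≡⟨ cong (λ u → k ⊓ Σs (j , u))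
                                                  (fe (λ p → cong ψ (slice-≡ p))) ⟩
            k ⊓ Σs (j , ψ ∘ at-𝟙)     ∎

      affineExtension-β : {j : 𝕀} (a : ConeJ PT j → 𝕀) (c : ConeJ PT j) →
        affineExtension a (incl j c) ≡ a c
      affineExtension-β {j} a (k , w) = ∥∥-rec (𝕀-isSet _ _) [ at-⊥ , at-⟦⟧ ] w
        where
          B : 𝕀
          B = Σs (j , λ p → a (𝟙 , ∣ inj₂ p ∣))

          at-⊥ : k ≡ 𝟘 → a (⊥ᶜ j) ⊔ (k ⊓ B) ≡ a (k , w)
          at-⊥ k≡0 = begin
            a (⊥ᶜ j) ⊔ (k ⊓ B)   ≡⟨ cong (λ m → a (⊥ᶜ j) ⊔ (m ⊓ B)) k≡0 ⟩
            a (⊥ᶜ j) ⊔ (𝟘 ⊓ B)   ≡⟨ i⊔[𝟘⊓j]≡i _ B ⟩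
            a (⊥ᶜ j)             ≡⟨ cong a (cone-≡ (sym k≡0)) ⟩
            a (k , w)            ∎

          at-⟦⟧ : ⟦ j ⟧ → a (⊥ᶜ j) ⊔ (k ⊓ B) ≡ a (k , w)
          at-⟦⟧ p = begin
            a (⊥ᶜ j) ⊔ (k ⊓ B)   ≡⟨ cong₂ (λ x y → x ⊔ (k ⊓ y)) (cong a (cone-≡ refl)) B≡α𝟙 ⟩
            α 𝟘 ⊔ (k ⊓ α 𝟙)      ≡⟨ sym (phoa-normalForm α k) ⟩
            α k                  ≡⟨ cong a (cone-≡ refl) ⟩
            a (k , w)            ∎
            where
              α : 𝕀 → 𝕀
              α m = a (m , ∣ inj₂ p ∣)

              B≡α𝟙 : B ≡ α 𝟙
              B≡α𝟙 = begin
                B                      ≡⟨ cong (λ u → Σs (j , u))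
                                             (fe (λ _ → cong a (cone-≡ refl))) ⟩
                Σs (j , λ _ → α 𝟙)     ≡⟨ fbm j (α 𝟙) ⟩
                j ⊓ α 𝟙                ≡⟨ cong (_⊓ α 𝟙) p ⟩
                𝟙 ⊓ α 𝟙                ≡⟨ ⊓-identityˡ (α 𝟙) ⟩
                α 𝟙                    ∎

      𝕀-basedSegalComplete : BasedSegalComplete PT 𝕀
      𝕀-basedSegalComplete j = isLocal-intro fe (incl j) 𝕀-isSet
        (λ a → affineExtension a , affineExtension-β a)
        (λ ψ ψ′ agree s → begin
          ψ s                                 ≡⟨ affineExtension-unique ψ s ⟩
          affineExtension (ψ ∘ incl j) s      ≡⟨ cong (λ a → affineExtension a s) (fe agree) ⟩
          affineExtension (ψ′ ∘ incl j) s     ≡⟨ sym (affineExtension-unique ψ′ s) ⟩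
          ψ′ s                                ∎)

      module _ (dp : DisjunctionProperty PT _⊔_) {X : Set} (SX : isSet X)
        (locX : BasedSegalComplete PT X) where

        L-restriction-injective : {j : 𝕀} (ψ ψ′ : Slice j → L X) →
          ((c : ConeJ PT j) → ψ (incl j c) ≡ ψ′ (incl j c)) → (s : Slice j) → ψ s ≡ ψ′ s
        L-restriction-injective {j} ψ ψ′ agree s = L-≡ (level s) λ r r′ →
          ∥∥-rec (SX _ _) [ (λ r⊥ → from-⊥ r⊥ r r′) , (λ p → from-⟦⟧ p r r′) ]′
            (⟦⟧-dichotomy dp (proj₁ ∘ ψ) s r)
          where
            level : (s : Slice j) → proj₁ (ψ s) ≡ proj₁ (ψ′ s)
            level = Local.restriction-injective (incl j) (𝕀-basedSegalComplete j) fe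
              (proj₁ ∘ ψ) (proj₁ ∘ ψ′) (cong proj₁ ∘ agree)

            from-⟦⟧ : ⟦ j ⟧ → (r : ⟦ proj₁ (ψ s) ⟧) (r′ : ⟦ proj₁ (ψ′ s) ⟧) →
              proj₂ (ψ s) r ≡ proj₂ (ψ′ s) r′
            from-⟦⟧ p = L-app (begin
              ψ s                          ≡⟨ cong ψ (sym (incl-cone-⟦⟧ p s)) ⟩
              ψ (incl j (cone-⟦⟧ p s))     ≡⟨ agree (cone-⟦⟧ p s) ⟩
              ψ′ (incl j (cone-⟦⟧ p s))    ≡⟨ cong ψ′ (incl-cone-⟦⟧ p s) ⟩
              ψ′ s                         ∎)

            from-⊥ : ⟦ proj₁ (ψ (⊥ˢ j)) ⟧ → (r : ⟦ proj₁ (ψ s) ⟧) (r′ : ⟦ proj₁ (ψ′ s) ⟧) →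
              proj₂ (ψ s) r ≡ proj₂ (ψ′ s) r′
            from-⊥ r⊥ r r′ = begin
              proj₂ (ψ s) r       ≡⟨ ⟦⟧-irrelevant (proj₂ (ψ s)) ⟩
              χ s                 ≡⟨ Local.restriction-injective (incl j) (locX j) fe χ χ′
                                       (λ c → L-app (agree c) _ _) s ⟩
              χ′ s                ≡⟨ ⟦⟧-irrelevant (proj₂ (ψ′ s)) ⟩
              proj₂ (ψ′ s) r′     ∎
              where
                total : (s : Slice j) → ⟦ proj₁ (ψ s) ⟧
                total = ⟦⟧-⊥⇒everywhere (proj₁ ∘ ψ) r⊥

                total′ : (s : Slice j) → ⟦ proj₁ (ψ′ s) ⟧
                total′ s = trans (sym (level s)) (total s)

                χ χ′ : Slice j → X
                χ s = proj₂ (ψ s) (total s)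
                χ′ s = proj₂ (ψ′ s) (total′ s)

        module L-Extension {j : 𝕀} (φ : ConeJ PT j → L X) where
          open Local (incl j) (locX j)

          a : ConeJ PT j → 𝕀
          a = proj₁ ∘ φ

          ā : Slice j → 𝕀
          ā = affineExtension a

          ⟦ā⟧⇒⟦a⟧ : (c : ConeJ PT j) → ⟦ ā (incl j c) ⟧ → ⟦ a c ⟧
          ⟦ā⟧⇒⟦a⟧ c = trans (sym (affineExtension-β a c))

          total : ⟦ ā (⊥ˢ j) ⟧ → ConeJ PT j → X
          total ā⊥ c = proj₂ (φ c) (⟦ā⟧⇒⟦a⟧ c (⟦⟧-⊥⇒everywhere ā ā⊥ (incl j c)))

          from-⊥ : (s : Slice j) → ⟦ ā (⊥ˢ j) ⟧ → X
          from-⊥ s ā⊥ = extend (total ā⊥) s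

          from-⟦⟧ : (s : Slice j) → ⟦ ā s ⟧ → ⟦ j ⟧ → X
          from-⟦⟧ s q p = proj₂ (φ (cone-⟦⟧ p s))
            (⟦ā⟧⇒⟦a⟧ (cone-⟦⟧ p s) (trans (cong ā (incl-cone-⟦⟧ p s)) q))

          from-⊥≡from-⟦⟧ : (s : Slice j) (q : ⟦ ā s ⟧) (ā⊥ : ⟦ ā (⊥ˢ j) ⟧) (p : ⟦ j ⟧) →
            from-⊥ s ā⊥ ≡ from-⟦⟧ s q p
          from-⊥≡from-⟦⟧ s q ā⊥ p = begin
            extend (total ā⊥) s                       ≡⟨ cong (extend (total ā⊥))
                                                             (sym (incl-cone-⟦⟧ p s)) ⟩
            extend (total ā⊥) (incl j (cone-⟦⟧ p s))  ≡⟨ extend-β (total ā⊥) (cone-⟦⟧ p s) ⟩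
            total ā⊥ (cone-⟦⟧ p s)                    ≡⟨ ⟦⟧-irrelevant (proj₂ (φ (cone-⟦⟧ p s))) ⟩
            from-⟦⟧ s q p                             ∎

          module Value (s : Slice j) (q : ⟦ ā s ⟧) = ∨-RecSet SX (𝕀-isSet _ _) (𝕀-isSet _ _)
            (from-⊥ s) (from-⟦⟧ s q) (from-⊥≡from-⟦⟧ s q)

          extension : Slice j → L X
          extension s = ā s , λ q → Value.∨-rec s q (⟦⟧-dichotomy dp ā s q)

          extension-β : (c : ConeJ PT j) → extension (incl j c) ≡ φ c
          extension-β c = L-≡ (affineExtension-β a c) λ q r′ →
            Value.∨-rec-≡ (incl j c) q _
              (λ ā⊥ → trans (extend-β (total ā⊥) c) (⟦⟧-irrelevant (proj₂ (φ c))))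
              (λ p → L-app (cong φ (cone-≡ refl)) _ r′)

        L-basedSegalComplete : BasedSegalComplete PT (L X)
        L-basedSegalComplete j = isLocal-intro fe (incl j) (isSet-L SX)
          (λ φ → L-Extension.extension φ , L-Extension.extension-β φ) L-restriction-injective

mainTheorem2 :
  (fe : FunExt) (PT : PropTrunc) (I : Interval) →
  let open Interval I in
  (_⊔_ : 𝕀 → 𝕀 → 𝕀) → IsBDL _⊔_ →
  (cons : Consistent) → Phoa → DisjunctionProperty PT _⊔_ →
  (Σs : L 𝕀 → 𝕀) → IsInternalSum Σs → FactorsBinaryMeets Σs →
  ((X : Set) → In𝒮 PT X → In𝒮 PT (L X))
  × ((X : Set) → In𝒮 PT X → (C : Set) → In𝒮 PT C →
       isEquiv (coconeMap fe cons X C))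
mainTheorem2 fe PT I _⊔_ bdl cons phoa dp Σs _ fbm =
  (λ X (SX , locX) → isSet-L fe PT I SX ,
                     L-basedSegalComplete fe PT I _⊔_ bdl phoa Σs fbm dp SX locX) ,
  (λ X _ C (SC , locC) → coconeMap-isEquiv fe PT I cons SC locC)
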